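{- Let $w\geq4$ be an integer and for every integer $n\geq1$ let $P_n=(a_n,a_{n-1})$. Then for all integers $n\geq 1$: (1) $P_n\in C(w)$; (2) $P_{2n}=(b_n\sqrt{w},\,c_{n-1})$; (3) $P_{2n+1}=(c_n,\,b_n\sqrt{w})$.
   Context: $C(w)=\{(x,y)\in\mathbb{R}^2: x^2-\sqrt{w}\,xy+y^2=1\}$. The sequences are: $a_0=0$, $a_1=1$, $a_{n+1}=\sqrt{w}\,a_n-a_{n-1}$; $b_0=0$, $b_1=1$, $b_{n+1}=(w-2)b_n-b_{n-1}$; $c_0=1$, $c_1=w-1$, $c_{n+1}=(w-2)c_n-c_{n-1}$ (recurrences for $n\geq1$). -}

module Defs where

open import Level using (_⊔_)
open import Data.Nat using (ℕ; zero; suc)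
open import Data.Product using (_×_)
open import Algebra.Bundles using (CommutativeRing)

-- All objects are interpreted in an arbitrary commutative ring R containing
-- an element s (playing the role of √w) with s * s ≈ w.  The real numbers
-- with s = √w are one instance; the paper's claims are ring identities.
module _ {c ℓ} (R : CommutativeRing c ℓ) where
  open CommutativeRing R

  _−_ : Carrier → Carrier → Carrier
  x − y = x + (- y)

  ι : ℕ → Carrier
  ι zero = 0#
  ι (suc n) = 1# + ι n

  seqA : Carrier → ℕ → Carrier
  seqA s zero = 0#
  seqA s (suc zero) = 1#
  seqA s (suc (suc n)) = (s * seqA s (suc n)) − seqA s n

  seqB : ℕ → ℕ → Carrier
  seqB w zero = 0#
  seqB w (suc zero) = 1#
  seqB w (suc (suc n)) = ((ι w − ι 2) * seqB w (suc n)) − seqB w n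

  seqC : ℕ → ℕ → Carrier
  seqC w zero = 1#
  seqC w (suc zero) = ι w − 1#
  seqC w (suc (suc n)) = ((ι w − ι 2) * seqC w (suc n)) − seqC w n

  OnCurve : Carrier → Carrier → Carrier → Set ℓ
  OnCurve s x y = ((x * x) − ((s * x) * y)) + (y * y) ≈ 1#

  PtEq : Carrier → Carrier → Carrier → Carrier → Set ℓ
  PtEq x y x' y' = (x ≈ x') × (y ≈ y')

module Submission where

-- The points P_n = (a_n, a_{n-1}) are studied through second-order linear
-- recurrences x_{k+2} + x_k = t x_{k+1} over an arbitrary commutative ring.
-- Three general facts about such sequences carry the whole proof:
--   * a solution is determined by its first two terms;
--   * for t = s the quadratic form Q(x, y) = x² − s x y + y² is constant
--     along consecutive pairs (x_{k+1}, x_k);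
--   * for t = s the subsequences of even and of odd indices satisfy the
--     recurrence with coefficient s² − 2.
-- Since s² = w, the even and odd parts of (a_n) solve the recurrence with
-- coefficient w − 2, which (b_n s) and (c_n) also solve; comparing the
-- first two terms identifies them, giving parts (2) and (3).  Part (1)
-- follows from the invariance of Q and Q(a_1, a_0) = Q(1, 0) = 1.

open import Defs
open import Data.Nat using (ℕ; zero; suc; _≤_; _∸_)
import Data.Nat as ℕ
open import Data.Nat.Properties using (*-suc)
open import Data.Product using (_×_; _,_; proj₁)
open import Algebra.Bundles using (CommutativeRing)
open import Relation.Binary.PropositionalEquality as ≡ using (_≡_)

-- 2n, defined so that double (suc n) unfolds to two successors.
double : ℕ → ℕ
double zero = zero
double (suc n) = suc (suc (double n))

double-correct : ∀ n → 2 ℕ.* n ≡ double n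
double-correct zero = ≡.refl
double-correct (suc n) =
  ≡.trans (*-suc 2 n) (≡.cong (λ m → suc (suc m)) (double-correct n))

module SecondOrderRecurrences {c ℓ} (R : CommutativeRing c ℓ) where
  open CommutativeRing R
  open import Algebra.Properties.Ring ring using (-0#≈0#; [y-z]x≈yx-zx)
  open import Algebra.Properties.AbelianGroup +-abelianGroup using (⁻¹-∙-comm)
  open import Algebra.Properties.CommutativeSemigroup +-commutativeSemigroup
    using (interchange; xy∙z≈zy∙x)
  open import Algebra.Properties.CommutativeSemigroup *-commutativeSemigroup
    using (xy∙z≈xz∙y; xy∙z≈y∙xz)
  open import Relation.Binary.Reasoning.Setoid setoid

  add⇒sub : ∀ {a b d} → a + b ≈ d → a ≈ d - b
  add⇒sub {a} {b} {d} a+b≈d = begin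
    a              ≈⟨ +-identityʳ a ⟨
    a + 0#         ≈⟨ +-congˡ (-‿inverseʳ b) ⟨
    a + (b - b)    ≈⟨ +-assoc a b (- b) ⟨
    (a + b) - b    ≈⟨ +-congʳ a+b≈d ⟩
    d - b          ∎

  sub⇒add : ∀ {a b d} → a ≈ d - b → a + b ≈ d
  sub⇒add {a} {b} {d} a≈d-b = begin
    a + b          ≈⟨ +-congʳ a≈d-b ⟩
    (d - b) + b    ≈⟨ +-assoc d (- b) b ⟩
    d + (- b + b)  ≈⟨ +-congˡ (-‿inverseˡ b) ⟩
    d + 0#         ≈⟨ +-identityʳ d ⟩
    d              ∎

  Solves : Carrier → (ℕ → Carrier) → Set ℓ
  Solves t x = ∀ k → x (suc (suc k)) + x k ≈ t * x (suc k)

  solves-by-definition : ∀ {t} x → (∀ k → x (suc (suc k)) ≈ t * x (suc k) - x k) →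
                         Solves t x
  solves-by-definition x step k = sub⇒add (step k)

  solves-cong : ∀ {t u x} → t ≈ u → Solves t x → Solves u x
  solves-cong t≈u sol k = trans (sol k) (*-congʳ t≈u)

  solves-scale : ∀ {t x} (r : Carrier) → Solves t x → Solves t (λ k → x k * r)
  solves-scale {t} {x} r sol k = begin
    x (suc (suc k)) * r + x k * r  ≈⟨ distribʳ r _ _ ⟨
    (x (suc (suc k)) + x k) * r    ≈⟨ *-congʳ (sol k) ⟩
    (t * x (suc k)) * r            ≈⟨ *-assoc t _ r ⟩
    t * (x (suc k) * r)            ∎

  solution-unique : ∀ {t x y} → Solves t x → Solves t y →
                    x 0 ≈ y 0 → x 1 ≈ y 1 → ∀ k → x k ≈ y k
  solution-unique {t} {x} {y} solx soly x₀≈y₀ x₁≈y₁ k = proj₁ (agree k)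
    where
    agree : ∀ k → x k ≈ y k × x (suc k) ≈ y (suc k)
    agree zero = x₀≈y₀ , x₁≈y₁
    agree (suc k) with agree k
    ... | xₖ≈yₖ , xₖ₊₁≈yₖ₊₁ = xₖ₊₁≈yₖ₊₁ , (begin
      x (suc (suc k))        ≈⟨ add⇒sub (solx k) ⟩
      t * x (suc k) - x k    ≈⟨ +-cong (*-congˡ xₖ₊₁≈yₖ₊₁) (-‿cong xₖ≈yₖ) ⟩
      t * y (suc k) - y k    ≈⟨ add⇒sub (soly k) ⟨
      y (suc (suc k))        ∎)

  two-times : ∀ a → ι R 2 * a ≈ a + a
  two-times a = begin
    (1# + (1# + 0#)) * a     ≈⟨ *-congʳ (+-congˡ (+-identityʳ 1#)) ⟩
    (1# + 1#) * a            ≈⟨ distribʳ a 1# 1# ⟩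
    1# * a + 1# * a          ≈⟨ +-cong (*-identityˡ a) (*-identityˡ a) ⟩
    a + a                    ∎

  -- Two steps of the recurrence with coefficient s form one step with
  -- coefficient s² − 2:  (x₄ + x₂) + (x₂ + x₀) = s (x₃ + x₁) = s² x₂.
  double-step : ∀ {s x} → Solves s x →
                ∀ k → x (4 ℕ.+ k) + x k ≈ (s * s - ι R 2) * x (2 ℕ.+ k)
  double-step {s} {x} sol k = trans (add⇒sub (begin
    (x₄ + x₀) + ι R 2 * x₂   ≈⟨ +-congˡ (two-times x₂) ⟩
    (x₄ + x₀) + (x₂ + x₂)    ≈⟨ interchange x₄ x₀ x₂ x₂ ⟩
    (x₄ + x₂) + (x₀ + x₂)    ≈⟨ +-cong (sol (2 ℕ.+ k)) (trans (+-comm x₀ x₂) (sol k)) ⟩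
    s * x₃ + s * x₁          ≈⟨ distribˡ s x₃ x₁ ⟨
    s * (x₃ + x₁)            ≈⟨ *-congˡ (sol (suc k)) ⟩
    s * (s * x₂)             ≈⟨ *-assoc s s x₂ ⟨
    (s * s) * x₂             ∎))
    (sym ([y-z]x≈yx-zx x₂ (s * s) (ι R 2)))
    where
    x₀ = x k
    x₁ = x (1 ℕ.+ k)
    x₂ = x (2 ℕ.+ k)
    x₃ = x (3 ℕ.+ k)
    x₄ = x (4 ℕ.+ k)

  evens : (ℕ → Carrier) → ℕ → Carrier
  evens x m = x (double m)

  evens-solves : ∀ {s x} → Solves s x → Solves (s * s - ι R 2) (evens x)
  evens-solves sol m = double-step sol (double m)

  Q : Carrier → Carrier → Carrier → Carrier
  Q s a b = (a * a - (s * a) * b) + b * b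

  -- Q is symmetric, which lets one formula serve both neighbouring pairs.
  Q-symmetric : ∀ s a b → Q s a b ≈ Q s b a
  Q-symmetric s a b = begin
    (a * a - (s * a) * b) + b * b   ≈⟨ xy∙z≈zy∙x (a * a) _ (b * b) ⟩
    (b * b - (s * a) * b) + a * a   ≈⟨ +-congʳ (+-congˡ (-‿cong (xy∙z≈xz∙y s a b))) ⟩
    (b * b - (s * b) * a) + a * a   ∎

  -- If a + c = s b then Q(a, b) = b² − a c; this is the common value of
  -- Q(a, b) and Q(b, c).
  Q-neighbours : ∀ {s a b d} → a + d ≈ s * b → Q s a b ≈ b * b - a * d
  Q-neighbours {s} {a} {b} {d} a+d≈sb = begin
    (a * a - (s * a) * b) + b * b   ≈⟨ +-congʳ (+-congˡ (-‿cong (xy∙z≈y∙xz s a b))) ⟩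
    (a * a - a * (s * b)) + b * b   ≈⟨ +-congʳ (+-congˡ (-‿cong (*-congˡ (sym a+d≈sb)))) ⟩
    (a * a - a * (a + d)) + b * b   ≈⟨ +-congʳ (+-congˡ (-‿cong (distribˡ a a d))) ⟩
    (a * a - (a * a + a * d)) + b * b ≈⟨ +-congʳ (+-congˡ (⁻¹-∙-comm _ _)) ⟨
    (a * a + (- (a * a) - a * d)) + b * b ≈⟨ +-congʳ (+-assoc _ _ _) ⟨
    ((a * a - a * a) - a * d) + b * b ≈⟨ +-congʳ (+-congʳ (-‿inverseʳ (a * a))) ⟩
    (0# - a * d) + b * b            ≈⟨ +-congʳ (+-identityˡ _) ⟩
    - (a * d) + b * b               ≈⟨ +-comm _ _ ⟩
    b * b - a * d                   ∎

  Q-step : ∀ {s a b d} → a + d ≈ s * b → Q s a b ≈ Q s b d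
  Q-step {s} {a} {b} {d} a+d≈sb = begin
    Q s a b         ≈⟨ Q-neighbours a+d≈sb ⟩
    b * b - a * d   ≈⟨ +-congˡ (-‿cong (*-comm a d)) ⟩
    b * b - d * a   ≈⟨ Q-neighbours (trans (+-comm d a) a+d≈sb) ⟨
    Q s d b         ≈⟨ Q-symmetric s d b ⟩
    Q s b d         ∎

  Q-invariant : ∀ {s x} → Solves s x → ∀ k → Q s (x (suc k)) (x k) ≈ Q s (x 1) (x 0)
  Q-invariant sol zero = refl
  Q-invariant sol (suc k) = trans (Q-step (sol k)) (Q-invariant sol k)

  Q-at-1-0 : ∀ s → Q s 1# 0# ≈ 1#
  Q-at-1-0 s = begin
    (1# * 1# - (s * 1#) * 0#) + 0# * 0#  ≈⟨ +-cong (+-cong (*-identityˡ 1#) (-‿cong (zeroʳ _))) (zeroˡ 0#) ⟩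
    (1# - 0#) + 0#                       ≈⟨ +-identityʳ _ ⟩
    1# - 0#                              ≈⟨ +-congˡ -0#≈0# ⟩
    1# + 0#                              ≈⟨ +-identityʳ 1# ⟩
    1#                                   ∎

module Sequences {ℓ₁ ℓ₂} (R : CommutativeRing ℓ₁ ℓ₂) (w : ℕ) (s : CommutativeRing.Carrier R)
                 (s²≈w : CommutativeRing._≈_ R (CommutativeRing._*_ R s s) (ι R w)) where
  open CommutativeRing R
  open SecondOrderRecurrences R
  open import Algebra.Properties.Ring ring using (-0#≈0#)
  open import Relation.Binary.Reasoning.Setoid setoid

  a b c : ℕ → Carrier
  a = seqA R s
  b = seqB R w
  c = seqC R w

  a-solves : Solves s a
  a-solves = solves-by-definition a (λ _ → refl)

  b-solves : Solves (ι R w - ι R 2) b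
  b-solves = solves-by-definition b (λ _ → refl)

  c-solves : Solves (ι R w - ι R 2) c
  c-solves = solves-by-definition c (λ _ → refl)

  a₂≈s : a 2 ≈ s
  a₂≈s = begin
    s * 1# - 0#   ≈⟨ +-congˡ -0#≈0# ⟩
    s * 1# + 0#   ≈⟨ +-identityʳ _ ⟩
    s * 1#        ≈⟨ *-identityʳ s ⟩
    s             ∎

  s²−2≈w−2 : s * s - ι R 2 ≈ ι R w - ι R 2
  s²−2≈w−2 = +-congʳ s²≈w

  -- a_{2m} = b_m s: both solve the recurrence with coefficient w − 2 and
  -- agree at m = 0, 1 (a_0 = 0, a_2 = s).
  a-even : ∀ m → a (double m) ≈ b m * s
  a-even = solution-unique
    (solves-cong s²−2≈w−2 (evens-solves a-solves))
    (solves-scale s b-solves)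
    (sym (zeroˡ s))
    (trans a₂≈s (sym (*-identityˡ s)))

  -- a_{2m+1} = c_m: the odd part is the even part of the shifted sequence,
  -- and a_1 = 1 = c_0, a_3 = s² − 1 = w − 1 = c_1.
  a-odd : ∀ m → a (suc (double m)) ≈ c m
  a-odd = solution-unique
    (solves-cong s²−2≈w−2 (evens-solves (λ k → a-solves (suc k))))
    c-solves
    refl
    (+-congʳ (trans (*-congˡ a₂≈s) s²≈w))

  -- Parts (1), (2), (3) for n = k + 1; the index 2n is converted to double n.
  on-curve : ∀ k → Q s (a (suc k)) (a k) ≈ 1#
  on-curve k = trans (Q-invariant a-solves k) (Q-at-1-0 s)

  even-point : ∀ k → PtEq R (a (2 ℕ.* suc k)) (a (2 ℕ.* suc k ∸ 1)) (b (suc k) * s) (c k)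
  even-point k = ≡.subst (λ m → PtEq R (a m) (a (m ∸ 1)) (b (suc k) * s) (c k))
                         (≡.sym (double-correct (suc k))) (a-even (suc k) , a-odd k)

  odd-point : ∀ k → PtEq R (a (suc (2 ℕ.* suc k))) (a (2 ℕ.* suc k)) (c (suc k)) (b (suc k) * s)
  odd-point k = ≡.subst (λ m → PtEq R (a (suc m)) (a m) (c (suc k)) (b (suc k) * s))
                        (≡.sym (double-correct (suc k))) (a-odd (suc k) , a-even (suc k))

open Data.Nat using (_*_)

proposition2 : ∀ {c ℓ} (R : CommutativeRing c ℓ) (w : ℕ) → 4 ≤ w →
               (s : CommutativeRing.Carrier R) →
               CommutativeRing._≈_ R (CommutativeRing._*_ R s s) (ι R w) →
               (n : ℕ) → 1 ≤ n →
               OnCurve R s (seqA R s n) (seqA R s (n ∸ 1))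
               × PtEq R (seqA R s (2 * n)) (seqA R s (2 * n ∸ 1))
                        (CommutativeRing._*_ R (seqB R w n) s) (seqC R w (n ∸ 1))
               × PtEq R (seqA R s (suc (2 * n))) (seqA R s (2 * n))
                        (seqC R w n) (CommutativeRing._*_ R (seqB R w n) s)
proposition2 R w _ s s²≈w zero ()
proposition2 R w _ s s²≈w (suc k) _ = on-curve k , even-point k , odd-point k
  where open Sequences R w s s²≈w
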